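{- Let $r\ge 0$ be an integer and let $D_m(r)$ denote the rencontres numbers. Then for every positive integer $n$, $$1 + \sum_{k=1}^n \frac{(-1)^k D_{k+r+3}(r)}{(k+2)\binom{k+r+3}{r}} = \frac{(-1)^n D_{n+r+2}(r)}{\binom{n+r+2}{r}}.$$
   Context: For integers $m\ge r\ge 0$, the rencontres number $D_m(r)$ is the number of permutations $\sigma$ of $[m]=\{1,\dots,m\}$ having exactly $r$ fixed points (points $k$ with $\sigma(k)=k$). In particular $D_m(0)=D_m$ is the number of derangements of $[m]$. -}

module Defs where

open import Data.Nat using (ℕ; zero; suc; _+_; _*_; _≤_; _<_; NonZero; >-nonZero)
open import Data.Nat.Properties using (+-suc; m*n≢0; ≤-refl; m≤m+n; m≤n+m; ≤-trans; +-monoˡ-≤; m≤n⇒m≤o+n; <-≤-trans; m<m+n)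
open import Data.Nat.Combinatorics using (_C_; nCk+nC[k+1]≡[n+1]C[k+1])
open import Data.Fin using (Fin)
open import Data.Fin.Properties using (all?) renaming (_≟_ to _≟F_)
open import Data.Vec using (Vec; []; _∷_; lookup)
open import Data.List using (List; []; _∷_; [_]; map; concatMap; filter; length; allFin)
open import Data.Product using (_×_)
open import Relation.Nullary using (Dec; _×-dec_; _→-dec_)
open import Relation.Binary.PropositionalEquality using (_≡_; refl; subst; sym)
open import Data.Rational using (ℚ; 0ℚ) renaming (_+_ to _+ℚ_)
import Data.Nat as ℕ

-- A map σ : [m] → [m] is encoded by the vector of its values
-- (σ(1),…,σ(m)) : Vec (Fin m) m; σ is a permutation iff it is
-- injective (on a finite set injective ⇔ bijective).

allVecs : (k m : ℕ) → List (Vec (Fin m) k)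
allVecs zero    m = [ [] ]
allVecs (suc k) m = concatMap (λ i → map (i ∷_) (allVecs k m)) (allFin m)

IsPermutation : {m : ℕ} → Vec (Fin m) m → Set
IsPermutation {m} σ = (i j : Fin m) → lookup σ i ≡ lookup σ j → i ≡ j

isPermutation? : {m : ℕ} → (σ : Vec (Fin m) m) → Dec (IsPermutation σ)
isPermutation? σ = all? λ i → all? λ j → (lookup σ i ≟F lookup σ j) →-dec (i ≟F j)

fixedPoints : {m : ℕ} → Vec (Fin m) m → ℕ
fixedPoints {m} σ = length (filter (λ i → lookup σ i ≟F i) (allFin m))

D : ℕ → ℕ → ℕ
D m r = length (filter (λ σ → isPermutation? σ ×-dec (fixedPoints σ ℕ.≟ r)) (allVecs m m))

∑₁ : ℕ → (ℕ → ℚ) → ℚ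
∑₁ zero    f = 0ℚ
∑₁ (suc n) f = ∑₁ n f +ℚ f (suc n)

private
  C-pos : ∀ s r → 0 < (s + r) C r
  C-pos s zero = subst (λ x → 0 < x C 0) (sym (Data.Nat.Properties.+-identityʳ s)) (ℕ.s≤s ℕ.z≤n)
    where import Data.Nat.Properties
  C-pos s (suc r) rewrite +-suc s r
    | sym (nCk+nC[k+1]≡[n+1]C[k+1] (s + r) r) =
    <-≤-trans (C-pos s r) (m≤m+n ((s + r) C r) _)

C-nz : ∀ n k → k ≤ n → NonZero (n C k)
C-nz n k k≤n = >-nonZero (subst (λ x → 0 < x C k) (Data.Nat.Properties.m∸n+n≡m k≤n) (C-pos (n ℕ.∸ k) k))
  where import Data.Nat.Properties

denom-nz : ∀ a r b → NonZero ((a + 2) * ((a + r + b) C r))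
denom-nz a r b = m*n≢0 (a + 2) ((a + r + b) C r)
  {{subst NonZero (sym (+-suc a 1)) _}}
  {{C-nz (a + r + b) r (≤-trans (m≤n+m r a) (m≤m+n (a + r) b))}}

binom-nz : ∀ a r b → NonZero ((a + r + b) C r)
binom-nz a r b = C-nz (a + r + b) r (≤-trans (m≤n+m r a) (m≤m+n (a + r) b))

-- Fill a permutation of [m] position by position. Once the first d positions
-- are filled, the number of ways to finish with exactly r fixed points only
-- depends on the number a of unused values ≥ d (the values that can still be
-- fixed points, since they are exactly the remaining positions) and the number
-- b of unused values < d: it is the number of permutations of a + b points with
-- exactly r fixed points among a designated ones, namely C(a,r) times the number
-- of permutations of (a − r) + b points fixing none of a − r designated ones.
-- Starting from a = m, b = 0 this gives D_m(r) = C(m,r) D_{m−r}. The summand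
-- therefore equals (−1)^k D_{k+3}/(k+2) = (−1)^k (D_{k+2} + D_{k+1}) by the
-- derangement recurrence, and the sum telescopes to (−1)^n D_{n+2} − D_2.

module Submission where

open import Defs
open import Data.Nat hiding (_/_)
open import Data.Nat.Properties
open import Data.Nat.Combinatorics using (_C_; nCk+nC[k+1]≡[n+1]C[k+1]; k>n⇒nCk≡0; nC1≡n)
open import Data.Nat.Tactic.RingSolver using (solve-∀)
open import Data.Bool using (Bool; true; false; not; _∧_; _∨_; if_then_else_)
open import Data.Bool.Properties using (∧-zeroʳ; not-injective)
open import Data.Fin using (Fin; zero; suc; toℕ; fromℕ<)
open import Data.Fin.Properties using (toℕ-injective; toℕ-fromℕ<) renaming (_≟_ to _≟ᶠ_)
import Data.Fin.Properties as Fin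
open import Data.Vec using (Vec; []; _∷_; lookup)
open import Data.List using (List; []; _∷_; map; concatMap; filter; length; tabulate; allFin; _++_)
open import Data.Product using (_×_; _,_; proj₁; proj₂)
open import Data.Integer using (ℤ; +_; -1ℤ) renaming (_*_ to _*ℤ_; _^_ to _^ℤ_)
import Data.Integer as ℤ
import Data.Integer.Properties as ℤP
import Data.Integer.Tactic.RingSolver as ℤ-Solver
open import Data.Rational using (ℚ; 1ℚ; _/_) renaming (_+_ to _+ℚ_)
import Data.Rational.Properties as ℚP
open import Data.Rational.Unnormalised using (mkℚᵘ; *≡*)
import Data.Rational.Unnormalised.Properties as ℚᵘP
open import Function using (_∘_)
open import Relation.Nullary using (does; yes; no; contradiction)
open import Relation.Nullary.Decidable using (dec-true; dec-false)
open import Relation.Unary using (Pred; Decidable)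
open import Relation.Binary using (tri<; tri≈; tri>)
open import Relation.Binary.PropositionalEquality
open import Algebra.Properties.Semiring.Sum +-*-semiring
  using (sum; sum-syntax; sum-cong-≗; ∑-distrib-+; *-distribʳ-sum)
open ≡-Reasoning

[1+k]*[1+n]C[1+k]≡[1+n]*nCk : ∀ n k → suc k * (suc n C suc k) ≡ suc n * (n C k)
[1+k]*[1+n]C[1+k]≡[1+n]*nCk zero    zero    = refl
[1+k]*[1+n]C[1+k]≡[1+n]*nCk zero    (suc k) = *-zeroʳ (suc (suc k))
[1+k]*[1+n]C[1+k]≡[1+n]*nCk (suc n) zero    =
  trans (+-identityʳ _) (trans (nC1≡n (suc (suc n))) (sym (*-identityʳ _)))
[1+k]*[1+n]C[1+k]≡[1+n]*nCk (suc n) (suc k) = begin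
  suc (suc k) * (suc (suc n) C suc (suc k))
    ≡⟨ cong (suc (suc k) *_) (nCk+nC[k+1]≡[n+1]C[k+1] (suc n) (suc k)) ⟨
  suc (suc k) * (suc n C suc k + suc n C suc (suc k))
    ≡⟨ regroup (suc k) (suc n C suc k) (suc n C suc (suc k)) ⟩
  suc n C suc k + suc k * (suc n C suc k) + suc (suc k) * (suc n C suc (suc k))
    ≡⟨ cong₂ (λ a b → suc n C suc k + a + b) (absorb n k) (absorb n (suc k)) ⟩
  suc n C suc k + suc n * (n C k) + suc n * (n C suc k)
    ≡⟨ cong (λ a → a + suc n * (n C k) + suc n * (n C suc k)) (nCk+nC[k+1]≡[n+1]C[k+1] n k) ⟨
  (n C k + n C suc k) + suc n * (n C k) + suc n * (n C suc k)
    ≡⟨ collect (n C k) (n C suc k) n ⟩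
  suc (suc n) * (n C k + n C suc k)
    ≡⟨ cong (suc (suc n) *_) (nCk+nC[k+1]≡[n+1]C[k+1] n k) ⟩
  suc (suc n) * (suc n C suc k) ∎
  where
  absorb = [1+k]*[1+n]C[1+k]≡[1+n]*nCk
  regroup : ∀ k y w → suc k * (y + w) ≡ y + k * y + suc k * w
  regroup = solve-∀
  collect : ∀ a b n → (a + b) + suc n * a + suc n * b ≡ suc (suc n) * (a + b)
  collect = solve-∀

[1+s]*[k+[1+s]]Ck≡[k+[1+s]]*[k+s]Ck : ∀ k s → suc s * ((k + suc s) C k) ≡ (k + suc s) * ((k + s) C k)
[1+s]*[k+[1+s]]Ck≡[k+[1+s]]*[k+s]Ck zero    s = refl
[1+s]*[k+[1+s]]Ck≡[k+[1+s]]*[k+s]Ck (suc k) s = *-cancelˡ-≡ _ _ (suc k) (begin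
  suc k * (suc s * (suc n C suc k))     ≡⟨ swap (suc k) (suc s) _ ⟩
  suc s * (suc k * (suc n C suc k))     ≡⟨ cong (suc s *_) (absorb n k) ⟩
  suc s * (suc n * (n C k))             ≡⟨ swap (suc s) (suc n) _ ⟩
  suc n * (suc s * (n C k))             ≡⟨ cong (suc n *_) ([1+s]*[k+[1+s]]Ck≡[k+[1+s]]*[k+s]Ck k s) ⟩
  suc n * (n * ((k + s) C k))           ≡⟨ cong (λ z → suc n * (z * ((k + s) C k))) (+-suc k s) ⟩
  suc n * (suc (k + s) * ((k + s) C k)) ≡⟨ cong (suc n *_) (absorb (k + s) k) ⟨
  suc n * (suc k * (suc (k + s) C suc k)) ≡⟨ swap (suc n) (suc k) _ ⟩
  suc k * (suc n * (suc (k + s) C suc k)) ∎)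
  where
  n = k + suc s
  absorb = [1+k]*[1+n]C[1+k]≡[1+n]*nCk
  swap : ∀ x y z → x * (y * z) ≡ y * (x * z)
  swap = solve-∀

-- Permutations with prescribed fixed points

-- noFixedAmong s p counts the permutations of s + p points fixing none of s
-- designated points; the recursion splits according to whether the first
-- designated point is sent to a designated or to a free point.
noFixedAmong : ℕ → ℕ → ℕ
noFixedAmong zero          p = p !
noFixedAmong (suc zero)    p = p * p !
noFixedAmong (suc (suc s)) p = suc s * noFixedAmong s (suc p) + p * noFixedAmong (suc s) p

-- Split according to whether the last free point is fixed.
noFixedAmong-free : ∀ s p → noFixedAmong s (suc p) ≡ noFixedAmong (suc s) p + noFixedAmong s p
noFixedAmong-free zero          p = +-comm (p !) (p * p !)
noFixedAmong-free (suc zero)    p = expand p (p !)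
  where
  expand : ∀ p f → suc p * (suc p * f) ≡ (1 * (suc p * f) + p * (p * f)) + p * f
  expand = solve-∀
noFixedAmong-free (suc (suc t)) p = begin
  suc t * E t (suc (suc p)) + suc p * E (suc t) (suc p)
    ≡⟨ cong (λ z → suc t * z + suc p * E (suc t) (suc p)) (noFixedAmong-free t (suc p)) ⟩
  suc t * (E (suc t) (suc p) + E t (suc p)) + suc p * E (suc t) (suc p)
    ≡⟨ cong (λ z → suc t * (z + E t (suc p)) + suc p * z) (noFixedAmong-free (suc t) p) ⟩
  suc t * ((e + E (suc t) p) + E t (suc p)) + suc p * (e + E (suc t) p)
    ≡⟨ rearrange t p (E t (suc p)) (E (suc t) p) ⟩
  (suc (suc t) * (e + E (suc t) p) + p * e) + e
    ≡⟨ cong (λ z → (suc (suc t) * z + p * e) + e) (noFixedAmong-free (suc t) p) ⟨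
  (suc (suc t) * E (suc t) (suc p) + p * E (suc (suc t)) p) + E (suc (suc t)) p ∎
  where
  E = noFixedAmong
  e = suc t * E t (suc p) + p * E (suc t) p
  rearrange : ∀ t p c f →
    suc t * (((suc t * c + p * f) + f) + c) + suc p * ((suc t * c + p * f) + f)
      ≡ (suc (suc t) * ((suc t * c + p * f) + f) + p * (suc t * c + p * f)) + (suc t * c + p * f)
  rearrange = solve-∀

noFixedAmong-suc : ∀ s p → noFixedAmong (suc s) p ≡ s * noFixedAmong (s ∸ 1) (suc p) + p * noFixedAmong s p
noFixedAmong-suc zero    p = refl
noFixedAmong-suc (suc s) p = refl

noFixedAmong-sucʳ : ∀ s p → noFixedAmong s (suc p) ≡ s * noFixedAmong (s ∸ 1) (suc p) + suc p * noFixedAmong s p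
noFixedAmong-sucʳ s p = begin
  E s (suc p)                                  ≡⟨ noFixedAmong-free s p ⟩
  E (suc s) p + E s p                          ≡⟨ cong (_+ E s p) (noFixedAmong-suc s p) ⟩
  s * E (s ∸ 1) (suc p) + p * E s p + E s p    ≡⟨ regroup (s * E (s ∸ 1) (suc p)) p (E s p) ⟩
  s * E (s ∸ 1) (suc p) + suc p * E s p        ∎
  where
  E = noFixedAmong
  regroup : ∀ x p y → x + p * y + y ≡ x + suc p * y
  regroup = solve-∀

-- fixedAmong j p r counts the permutations of j + p points having exactly r
-- fixed points among j designated points.
fixedAmong : ℕ → ℕ → ℕ → ℕ
fixedAmong j p r = (j C r) * noFixedAmong (j ∸ r) p

shift : (ℕ → ℕ) → ℕ → ℕ
shift f zero    = 0
shift f (suc r) = f r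

data Excess (r : ℕ) : ℕ → Set where
  short : ∀ {j} → j < r → Excess r j
  plus  : ∀ s → Excess r (r + s)

excess : ∀ r j → Excess r j
excess zero    j       = plus j
excess (suc r) zero    = short z<s
excess (suc r) (suc j) with excess r j
... | short j<r = short (s<s j<r)
... | plus s    = plus s

fixedAmong-short : ∀ {j r} p → j < r → fixedAmong j p r ≡ 0
fixedAmong-short {j} {r} p j<r = cong (_* noFixedAmong (j ∸ r) p) (k>n⇒nCk≡0 j<r)

fixedAmong-plus : ∀ r s p → fixedAmong (r + s) p r ≡ ((r + s) C r) * noFixedAmong s p
fixedAmong-plus r s p = cong (λ z → ((r + s) C r) * noFixedAmong z p) (m+n∸m≡n r s)

fixedAmong-pred : ∀ r s q → (r + s) * fixedAmong (r + s ∸ 1) q r ≡ s * ((r + s) C r) * noFixedAmong (s ∸ 1) q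
fixedAmong-pred zero    zero    q = refl
fixedAmong-pred (suc r) zero    q = begin
  (suc r + 0) * fixedAmong (suc r + 0 ∸ 1) q (suc r)
    ≡⟨ cong ((suc r + 0) *_) (fixedAmong-short q (≤-reflexive (cong suc (+-identityʳ r)))) ⟩
  (suc r + 0) * 0
    ≡⟨ *-zeroʳ (suc r + 0) ⟩
  0 ∎
fixedAmong-pred r       (suc t) q = begin
  (r + suc t) * fixedAmong (r + suc t ∸ 1) q r
    ≡⟨ cong (λ z → (r + suc t) * fixedAmong (z ∸ 1) q r) (+-suc r t) ⟩
  (r + suc t) * fixedAmong (r + t) q r
    ≡⟨ cong ((r + suc t) *_) (fixedAmong-plus r t q) ⟩
  (r + suc t) * (((r + t) C r) * noFixedAmong t q)
    ≡⟨ *-assoc (r + suc t) _ _ ⟨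
  (r + suc t) * ((r + t) C r) * noFixedAmong t q
    ≡⟨ cong (_* noFixedAmong t q) ([1+s]*[k+[1+s]]Ck≡[k+[1+s]]*[k+s]Ck r t) ⟨
  suc t * ((r + suc t) C r) * noFixedAmong t q ∎

fixedAmong-zero : ∀ j p → fixedAmong j p 0 ≡ noFixedAmong j p
fixedAmong-zero j p = *-identityˡ (noFixedAmong j p)

fixedAmong-sucʳ : ∀ j p r →
  fixedAmong j (suc p) r ≡ j * fixedAmong (j ∸ 1) (suc p) r + suc p * fixedAmong j p r
fixedAmong-sucʳ j p r with excess r j
... | short j<r = begin
  fixedAmong j (suc p) r                                    ≡⟨ fixedAmong-short (suc p) j<r ⟩
  0                                                         ≡⟨ cong₂ _+_ (*-zeroʳ j) (*-zeroʳ (suc p)) ⟨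
  j * 0 + suc p * 0                                         ≡⟨ cong₂ (λ a b → j * a + suc p * b)
                                                                 (fixedAmong-short (suc p) (≤-<-trans (m∸n≤m j 1) j<r))
                                                                 (fixedAmong-short p j<r) ⟨
  j * fixedAmong (j ∸ 1) (suc p) r + suc p * fixedAmong j p r ∎
... | plus s = begin
  fixedAmong (r + s) (suc p) r                          ≡⟨ fixedAmong-plus r s (suc p) ⟩
  c * E s (suc p)                                       ≡⟨ cong (c *_) (noFixedAmong-sucʳ s p) ⟩
  c * (s * E (s ∸ 1) (suc p) + suc p * E s p)           ≡⟨ distribute c s (E (s ∸ 1) (suc p)) (suc p) (E s p) ⟩
  s * c * E (s ∸ 1) (suc p) + suc p * (c * E s p)       ≡⟨ cong₂ _+_ (fixedAmong-pred r s (suc p))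
                                                             (cong (suc p *_) (fixedAmong-plus r s p)) ⟨
  (r + s) * fixedAmong (r + s ∸ 1) (suc p) r + suc p * fixedAmong (r + s) p r ∎
  where
  E = noFixedAmong
  c = (r + s) C r
  distribute : ∀ c s e q f → c * (s * e + q * f) ≡ s * c * e + q * (c * f)
  distribute = solve-∀

fixedAmong-suc-remainder : ∀ r s p → ((r + s) C suc r) * noFixedAmong s p ≡
  (r + s) * fixedAmong (r + s ∸ 1) (suc p) (suc r) + p * fixedAmong (r + s) p (suc r)
fixedAmong-suc-remainder r zero p = begin
  ((r + 0) C suc r) * noFixedAmong 0 p          ≡⟨ cong (_* noFixedAmong 0 p) (k>n⇒nCk≡0 r+0<1+r) ⟩
  0                                             ≡⟨ cong₂ _+_ (*-zeroʳ (r + 0)) (*-zeroʳ p) ⟨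
  (r + 0) * 0 + p * 0                           ≡⟨ cong₂ (λ a b → (r + 0) * a + p * b)
                                                     (fixedAmong-short (suc p) (≤-<-trans (m∸n≤m (r + 0) 1) r+0<1+r))
                                                     (fixedAmong-short p r+0<1+r) ⟨
  (r + 0) * fixedAmong (r + 0 ∸ 1) (suc p) (suc r) + p * fixedAmong (r + 0) p (suc r) ∎
  where
  r+0<1+r : r + 0 < suc r
  r+0<1+r = s≤s (≤-reflexive (+-identityʳ r))
fixedAmong-suc-remainder r (suc t) p rewrite +-suc r t = begin
  c * E (suc t) p                               ≡⟨ cong (c *_) (noFixedAmong-suc t p) ⟩
  c * (t * E (t ∸ 1) (suc p) + p * E t p)       ≡⟨ distribute c t (E (t ∸ 1) (suc p)) p (E t p) ⟩
  t * c * E (t ∸ 1) (suc p) + p * (c * E t p)   ≡⟨ cong₂ _+_ (fixedAmong-pred (suc r) t (suc p))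
                                                     (cong (p *_) (fixedAmong-plus (suc r) t p)) ⟨
  suc (r + t) * fixedAmong (r + t) (suc p) (suc r) + p * fixedAmong (suc (r + t)) p (suc r) ∎
  where
  E = noFixedAmong
  c = (suc r + t) C suc r
  distribute : ∀ c s e q f → c * (s * e + q * f) ≡ s * c * e + q * (c * f)
  distribute = solve-∀

fixedAmong-suc : ∀ j p r →
  fixedAmong (suc j) p r ≡ shift (fixedAmong j p) r + j * fixedAmong (j ∸ 1) (suc p) r + p * fixedAmong j p r
fixedAmong-suc j p zero = begin
  fixedAmong (suc j) p 0                                  ≡⟨ fixedAmong-zero (suc j) p ⟩
  noFixedAmong (suc j) p                                  ≡⟨ noFixedAmong-suc j p ⟩
  j * noFixedAmong (j ∸ 1) (suc p) + p * noFixedAmong j p ≡⟨ cong₂ (λ a b → j * a + p * b)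
                                                               (fixedAmong-zero (j ∸ 1) (suc p)) (fixedAmong-zero j p) ⟨
  j * fixedAmong (j ∸ 1) (suc p) 0 + p * fixedAmong j p 0 ∎
fixedAmong-suc j p (suc r) with excess r j
... | short j<r = begin
  fixedAmong (suc j) p (suc r)  ≡⟨ fixedAmong-short p (s<s j<r) ⟩
  0                             ≡⟨ cong₂ _+_ (*-zeroʳ j) (*-zeroʳ p) ⟨
  0 + j * 0 + p * 0             ≡⟨ cong₃ (fixedAmong-short p j<r)
                                     (fixedAmong-short (suc p) (≤-<-trans (m∸n≤m j 1) (m<n⇒m<1+n j<r)))
                                     (fixedAmong-short p (m<n⇒m<1+n j<r)) ⟨
  fixedAmong j p r + j * fixedAmong (j ∸ 1) (suc p) (suc r) + p * fixedAmong j p (suc r) ∎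
  where
  cong₃ : ∀ {a a′ b b′ c c′} → a ≡ a′ → b ≡ b′ → c ≡ c′ → a + j * b + p * c ≡ a′ + j * b′ + p * c′
  cong₃ refl refl refl = refl
... | plus s = begin
  fixedAmong (suc r + s) p (suc r)                    ≡⟨ fixedAmong-plus (suc r) s p ⟩
  (suc (r + s) C suc r) * E s p                       ≡⟨ cong (_* E s p) (nCk+nC[k+1]≡[n+1]C[k+1] (r + s) r) ⟨
  ((r + s) C r + (r + s) C suc r) * E s p             ≡⟨ *-distribʳ-+ (E s p) ((r + s) C r) _ ⟩
  ((r + s) C r) * E s p + ((r + s) C suc r) * E s p
    ≡⟨ cong₂ _+_ (fixedAmong-plus r s p) (sym (fixedAmong-suc-remainder r s p)) ⟨
  fixedAmong (r + s) p r + ((r + s) * fixedAmong (r + s ∸ 1) (suc p) (suc r) + p * fixedAmong (r + s) p (suc r))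
    ≡⟨ +-assoc (fixedAmong (r + s) p r) _ _ ⟨
  fixedAmong (r + s) p r + (r + s) * fixedAmong (r + s ∸ 1) (suc p) (suc r) + p * fixedAmong (r + s) p (suc r) ∎
  where
  E = noFixedAmong

𝟙 : Bool → ℕ
𝟙 b = if b then 1 else 0

count : ∀ {A : Set} → (A → Bool) → List A → ℕ
count p []       = 0
count p (x ∷ xs) = 𝟙 (p x) + count p xs

length-filter≡count : ∀ {A : Set} {ℓ} {P : Pred A ℓ} (P? : Decidable P) xs →
  length (filter P? xs) ≡ count (does ∘ P?) xs
length-filter≡count P? []       = refl
length-filter≡count P? (x ∷ xs) with does (P? x)
... | false = length-filter≡count P? xs
... | true  = cong suc (length-filter≡count P? xs)

count-cong : ∀ {A : Set} {p q : A → Bool} → (∀ x → p x ≡ q x) → ∀ xs → count p xs ≡ count q xs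
count-cong p≗q []       = refl
count-cong p≗q (x ∷ xs) = cong₂ (λ b n → 𝟙 b + n) (p≗q x) (count-cong p≗q xs)

count-false : ∀ {A : Set} (xs : List A) → count (λ _ → false) xs ≡ 0
count-false []       = refl
count-false (x ∷ xs) = count-false xs

count-++ : ∀ {A : Set} (p : A → Bool) xs ys → count p (xs ++ ys) ≡ count p xs + count p ys
count-++ p []       ys = refl
count-++ p (x ∷ xs) ys = trans (cong (_+_ (𝟙 (p x))) (count-++ p xs ys)) (sym (+-assoc (𝟙 (p x)) _ _))

count-map : ∀ {A B : Set} (p : B → Bool) (f : A → B) xs → count p (map f xs) ≡ count (p ∘ f) xs
count-map p f []       = refl
count-map p f (x ∷ xs) = cong (_+_ (𝟙 (p (f x)))) (count-map p f xs)

count-concatMap-tabulate : ∀ {A B : Set} {n} (p : B → Bool) (g : A → List B) (f : Fin n → A) →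
  count p (concatMap g (tabulate f)) ≡ ∑[ i < n ] count p (g (f i))
count-concatMap-tabulate {n = zero}  p g f = refl
count-concatMap-tabulate {n = suc n} p g f =
  trans (count-++ p (g (f zero)) _) (cong (_+_ (count p (g (f zero)))) (count-concatMap-tabulate p g (f ∘ suc)))

count-tabulate : ∀ {A : Set} {n} (p : A → Bool) (f : Fin n → A) → count p (tabulate f) ≡ ∑[ i < n ] 𝟙 (p (f i))
count-tabulate {n = zero}  p f = refl
count-tabulate {n = suc n} p f = cong (_+_ (𝟙 (p (f zero)))) (count-tabulate p (f ∘ suc))

countFin : ∀ {n} → (Fin n → Bool) → ℕ
countFin {n} P = ∑[ x < n ] 𝟙 (P x)

countFin-true : ∀ n → countFin {n} (λ _ → true) ≡ n
countFin-true zero    = refl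
countFin-true (suc n) = cong suc (countFin-true n)

countFin-false : ∀ n → countFin {n} (λ _ → false) ≡ 0
countFin-false zero    = refl
countFin-false (suc n) = countFin-false n

countFin-toℕ : ∀ {n} (i : Fin n) (P : Fin n → Bool) → countFin (λ x → (toℕ x ≡ᵇ toℕ i) ∧ P x) ≡ 𝟙 (P i)
countFin-toℕ {suc n} zero    P = trans (cong (_+_ (𝟙 (P zero))) (countFin-false n)) (+-identityʳ _)
countFin-toℕ {suc n} (suc i) P = countFin-toℕ i (P ∘ suc)

countFin-≥ : ∀ n e → countFin {n} (λ x → not (toℕ x <ᵇ e)) ≡ n ∸ e
countFin-≥ zero    zero    = refl
countFin-≥ zero    (suc e) = refl
countFin-≥ (suc n) zero    = cong suc (countFin-true n)
countFin-≥ (suc n) (suc e) = countFin-≥ n e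

sum-mono-≤ : ∀ {n} {f g : Fin n → ℕ} → (∀ i → f i ≤ g i) → sum f ≤ sum g
sum-mono-≤ {zero}  f≤g = z≤n
sum-mono-≤ {suc n} f≤g = +-mono-≤ (f≤g zero) (sum-mono-≤ (f≤g ∘ suc))

does-≟ᶠ : ∀ {n} (x y : Fin n) → does (x ≟ᶠ y) ≡ (toℕ x ≡ᵇ toℕ y)
does-≟ᶠ x y with x ≟ᶠ y
... | yes refl = sym (dec-true (toℕ x ≟ toℕ x) refl)
... | no  x≢y  = sym (dec-false (toℕ x ≟ toℕ y) (x≢y ∘ toℕ-injective))

countFin-≟ : ∀ {n} (i : Fin n) (P : Fin n → Bool) → countFin (λ x → does (x ≟ᶠ i) ∧ P x) ≡ 𝟙 (P i)
countFin-≟ i P = trans (sum-cong-≗ λ x → cong (λ b → 𝟙 (b ∧ P x)) (does-≟ᶠ x i)) (countFin-toℕ i P)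

data Position (n d : ℕ) : Set where
  below : n < d → (n ≡ᵇ d) ≡ false → (n <ᵇ d) ≡ true  → (n <ᵇ suc d) ≡ true  → Position n d
  at    : n ≡ d → (n ≡ᵇ d) ≡ true  → (n <ᵇ d) ≡ false → (n <ᵇ suc d) ≡ true  → Position n d
  above : d < n → (n ≡ᵇ d) ≡ false → (n <ᵇ d) ≡ false → (n <ᵇ suc d) ≡ false → Position n d

position : ∀ n d → Position n d
position n d with <-cmp n d
... | tri< n<d n≢d _ = below n<d (dec-false (n ≟ d) n≢d) (dec-true (n <? d) n<d)
                         (dec-true (n <? suc d) (m<n⇒m<1+n n<d))
... | tri≈ n≮d n≡d _ = at n≡d (dec-true (n ≟ d) n≡d) (dec-false (n <? d) n≮d)
                         (dec-true (n <? suc d) (s≤s (≤-reflexive n≡d)))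
... | tri> n≮d n≢d d<n = above d<n (dec-false (n ≟ d) n≢d) (dec-false (n <? d) n≮d)
                           (dec-false (n <? suc d) (λ n<1+d → <⇒≱ d<n (s≤s⁻¹ n<1+d)))

-- free tells whether the value of the first position is itself still unused.
fixedAmong-first-position : ∀ a b r (free : Bool) → (free ≡ false → 0 < b) →
  𝟙 free * shift (fixedAmong a (𝟙 free + b ∸ 1)) r + a * fixedAmong (a ∸ 1) (𝟙 free + b) r
    + b * fixedAmong a (𝟙 free + b ∸ 1) r ≡ fixedAmong (𝟙 free + a) b r
fixedAmong-first-position a b r true _ =
  trans (cong (λ z → z + a * fixedAmong (a ∸ 1) (suc b) r + b * fixedAmong a b r) (*-identityˡ _))
        (sym (fixedAmong-suc a b r))
fixedAmong-first-position a (suc b) r false _ = sym (fixedAmong-sucʳ a b r)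
fixedAmong-first-position a zero    r false 0<b with () ← 0<b refl

m+n≡o⇒m≡o∸n : ∀ {m n o} → m + n ≡ o → m ≡ o ∸ n
m+n≡o⇒m≡o∸n {m} {n} refl = sym (m+n∸n≡m m n)

shift-cong : ∀ {f g : ℕ → ℕ} → (∀ r → f r ≡ g r) → ∀ r → shift f r ≡ shift g r
shift-cong f≗g zero    = refl
shift-cong f≗g (suc r) = f≗g r

-- Filling a permutation position by position

module Arrangements (m : ℕ) where

  Used : Set
  Used = Fin m → Bool

  insert : Fin m → Used → Used
  insert i S x = does (x ≟ᶠ i) ∨ S x

  fresh : ∀ {k} → Used → Vec (Fin m) k → Bool
  fresh S []      = true
  fresh S (x ∷ v) = not (S x) ∧ fresh (insert x S) v

  fixedFrom : ∀ {k} → ℕ → Vec (Fin m) k → ℕ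
  fixedFrom d []      = 0
  fixedFrom d (x ∷ v) = 𝟙 (toℕ x ≡ᵇ d) + fixedFrom (suc d) v

  arrangements : ℕ → ℕ → Used → ℕ → ℕ
  arrangements d k S r = count (λ v → fresh S v ∧ (fixedFrom d v ≡ᵇ r)) (allVecs k m)

  startingWith : ℕ → ℕ → Used → ℕ → Fin m → ℕ
  startingWith d k S r i =
    if S i then 0
    else if toℕ i ≡ᵇ d then shift (arrangements (suc d) k (insert i S)) r
    else arrangements (suc d) k (insert i S) r

  arrangements-suc : ∀ d k S r → arrangements d (suc k) S r ≡ ∑[ i < m ] startingWith d k S r i
  arrangements-suc d k S r =
    trans (count-concatMap-tabulate _ (λ i → map (i ∷_) (allVecs k m)) (λ i → i))
          (sum-cong-≗ λ i → trans (count-map _ (i ∷_) (allVecs k m)) (first-value i r))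
    where
    first-value : ∀ i r →
      count (λ v → fresh S (i ∷ v) ∧ (fixedFrom d (i ∷ v) ≡ᵇ r)) (allVecs k m) ≡ startingWith d k S r i
    first-value i r with S i | toℕ i ≡ᵇ d | r
    ... | true  | _     | _     = count-false (allVecs k m)
    ... | false | false | _     = refl
    ... | false | true  | zero  = trans (count-cong (λ v → ∧-zeroʳ (fresh (insert i S) v)) (allVecs k m))
                                        (count-false (allVecs k m))
    ... | false | true  | suc _ = refl

  unusedFrom : ℕ → Used → ℕ
  unusedFrom d S = countFin (λ x → not (S x) ∧ not (toℕ x <ᵇ d))

  unusedBelow : ℕ → Used → ℕ
  unusedBelow d S = countFin (λ x → not (S x) ∧ (toℕ x <ᵇ d))

  unused : Used → ℕ
  unused = unusedFrom 0

  unused-split : ∀ d S → unused S ≡ unusedFrom d S + unusedBelow d S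
  unused-split d S = trans (sum-cong-≗ λ x → split (S x) (toℕ x <ᵇ d))
                           (∑-distrib-+ (λ x → 𝟙 (not (S x) ∧ not (toℕ x <ᵇ d))) (λ x → 𝟙 (not (S x) ∧ (toℕ x <ᵇ d))))
    where
    split : ∀ s b → 𝟙 (not s ∧ true) ≡ 𝟙 (not s ∧ not b) + 𝟙 (not s ∧ b)
    split true  b     = refl
    split false false = refl
    split false true  = refl

  count-insert : ∀ i S (c : Fin m → Bool) → S i ≡ false →
    countFin (λ x → not (insert i S x) ∧ c x) + 𝟙 (c i) ≡ countFin (λ x → not (S x) ∧ c x)
  count-insert i S c Si = begin
    countFin (λ x → not (insert i S x) ∧ c x) + 𝟙 (c i)
      ≡⟨ cong (_+_ (countFin (λ x → not (insert i S x) ∧ c x))) (countFin-≟ i c) ⟨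
    countFin (λ x → not (insert i S x) ∧ c x) + countFin (λ x → does (x ≟ᶠ i) ∧ c x)
      ≡⟨ ∑-distrib-+ (λ x → 𝟙 (not (insert i S x) ∧ c x)) (λ x → 𝟙 (does (x ≟ᶠ i) ∧ c x)) ⟨
    ∑[ x < m ] (𝟙 (not (insert i S x) ∧ c x) + 𝟙 (does (x ≟ᶠ i) ∧ c x))
      ≡⟨ sum-cong-≗ remove ⟩
    countFin (λ x → not (S x) ∧ c x) ∎
    where
    remove : ∀ x → 𝟙 (not (insert i S x) ∧ c x) + 𝟙 (does (x ≟ᶠ i) ∧ c x) ≡ 𝟙 (not (S x) ∧ c x)
    remove x with x ≟ᶠ i
    ... | yes refl rewrite Si = refl
    ... | no _                = +-identityʳ _

  unusedFrom-split : ∀ d S (x₀ : Fin m) → toℕ x₀ ≡ d → unusedFrom d S ≡ 𝟙 (not (S x₀)) + unusedFrom (suc d) S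
  unusedFrom-split _ S x₀ refl =
    trans (sum-cong-≗ λ x → split (toℕ x) (toℕ x₀) (S x))
          (trans (∑-distrib-+ (λ x → 𝟙 ((toℕ x ≡ᵇ toℕ x₀) ∧ not (S x))) (λ x → 𝟙 (not (S x) ∧ not (toℕ x <ᵇ suc (toℕ x₀)))))
                 (cong (_+ unusedFrom (suc (toℕ x₀)) S) (countFin-toℕ x₀ (not ∘ S))))
    where
    split : ∀ n d s → 𝟙 (not s ∧ not (n <ᵇ d)) ≡ 𝟙 ((n ≡ᵇ d) ∧ not s) + 𝟙 (not s ∧ not (n <ᵇ suc d))
    split n d true  = sym (trans (+-identityʳ _) (cong 𝟙 (∧-zeroʳ (n ≡ᵇ d))))
    split n d false with position n d
    ... | below _ e l l′ rewrite e | l | l′ = refl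
    ... | at    _ e l l′ rewrite e | l | l′ = refl
    ... | above _ e l l′ rewrite e | l | l′ = refl

  unusedBelow-split : ∀ d S (x₀ : Fin m) → toℕ x₀ ≡ d → unusedBelow (suc d) S ≡ 𝟙 (not (S x₀)) + unusedBelow d S
  unusedBelow-split _ S x₀ refl =
    trans (sum-cong-≗ λ x → split (toℕ x) (toℕ x₀) (S x))
          (trans (∑-distrib-+ (λ x → 𝟙 ((toℕ x ≡ᵇ toℕ x₀) ∧ not (S x))) (λ x → 𝟙 (not (S x) ∧ (toℕ x <ᵇ toℕ x₀))))
                 (cong (_+ unusedBelow (toℕ x₀) S) (countFin-toℕ x₀ (not ∘ S))))
    where
    split : ∀ n d s → 𝟙 (not s ∧ (n <ᵇ suc d)) ≡ 𝟙 ((n ≡ᵇ d) ∧ not s) + 𝟙 (not s ∧ (n <ᵇ d))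
    split n d true  = sym (trans (+-identityʳ _) (cong 𝟙 (∧-zeroʳ (n ≡ᵇ d))))
    split n d false with position n d
    ... | below _ e l l′ rewrite e | l | l′ = refl
    ... | at    _ e l l′ rewrite e | l | l′ = refl
    ... | above _ e l l′ rewrite e | l | l′ = refl

  unusedFrom-≤ : ∀ e S → unusedFrom e S ≤ m ∸ e
  unusedFrom-≤ e S =
    ≤-trans (sum-mono-≤ (λ x → 𝟙-∧-≤ (not (S x)) (not (toℕ x <ᵇ e)))) (≤-reflexive (countFin-≥ m e))
    where
    𝟙-∧-≤ : ∀ a b → 𝟙 (a ∧ b) ≤ 𝟙 b
    𝟙-∧-≤ false b = z≤n
    𝟙-∧-≤ true  b = ≤-refl

  arrangements-by-position : ∀ d k S r α β γ →
    (∀ i → S i ≡ false → toℕ i ≡ d → shift (arrangements (suc d) k (insert i S)) r ≡ α) →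
    (∀ i → S i ≡ false → d < toℕ i → arrangements (suc d) k (insert i S) r ≡ β) →
    (∀ i → S i ≡ false → toℕ i < d → arrangements (suc d) k (insert i S) r ≡ γ) →
    arrangements d (suc k) S r ≡
      countFin (λ x → (toℕ x ≡ᵇ d) ∧ not (S x)) * α + unusedFrom (suc d) S * β + unusedBelow d S * γ
  arrangements-by-position d k S r α β γ hα hβ hγ = begin
    arrangements d (suc k) S r
      ≡⟨ arrangements-suc d k S r ⟩
    ∑[ i < m ] startingWith d k S r i
      ≡⟨ sum-cong-≗ classify ⟩
    ∑[ i < m ] (A i * α + B i * β + C i * γ)
      ≡⟨ ∑-distrib-+ (λ i → A i * α + B i * β) (λ i → C i * γ) ⟩
    ∑[ i < m ] (A i * α + B i * β) + ∑[ i < m ] (C i * γ)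
      ≡⟨ cong (_+ ∑[ i < m ] (C i * γ)) (∑-distrib-+ (λ i → A i * α) (λ i → B i * β)) ⟩
    ∑[ i < m ] (A i * α) + ∑[ i < m ] (B i * β) + ∑[ i < m ] (C i * γ)
      ≡⟨ cong₂ _+_ (cong₂ _+_ (*-distribʳ-sum α A) (*-distribʳ-sum β B)) (*-distribʳ-sum γ C) ⟨
    sum A * α + sum B * β + sum C * γ ∎
    where
    A B C : Fin m → ℕ
    A i = 𝟙 ((toℕ i ≡ᵇ d) ∧ not (S i))
    B i = 𝟙 (not (S i) ∧ not (toℕ i <ᵇ suc d))
    C i = 𝟙 (not (S i) ∧ (toℕ i <ᵇ d))
    classify : ∀ i → startingWith d k S r i ≡ A i * α + B i * β + C i * γ
    classify i with S i in Si | position (toℕ i) d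
    ... | true  | _ rewrite ∧-zeroʳ (toℕ i ≡ᵇ d) = refl
    ... | false | below i<d e l l′ rewrite e | l | l′ =
      trans (hγ i Si i<d) (sym (+-identityʳ γ))
    ... | false | at    i≡d e l l′ rewrite e | l | l′ =
      trans (hα i Si i≡d) (sym (trans (+-identityʳ _) (trans (+-identityʳ _) (+-identityʳ α))))
    ... | false | above d<i e l l′ rewrite e | l | l′ =
      trans (hβ i Si d<i) (sym (trans (+-identityʳ _) (+-identityʳ β)))

  -- The unused values ≥ d are the remaining positions: the points that can still be fixed.
  Invariant : ℕ → ℕ → Set
  Invariant d k = ∀ S r → unused S ≡ k →
    arrangements d k S r ≡ fixedAmong (unusedFrom d S) (unusedBelow d S) r

  arrangements-insert : ∀ {d k} S i {t} → Invariant (suc d) k → unused S ≡ suc k → S i ≡ false →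
    (toℕ i <ᵇ suc d) ≡ t → ∀ r →
    arrangements (suc d) k (insert i S) r ≡ fixedAmong (unusedFrom (suc d) S ∸ 𝟙 (not t)) (unusedBelow (suc d) S ∸ 𝟙 t) r
  arrangements-insert {d} S i IH unused≡1+k Si refl r = trans
    (IH (insert i S) r (suc-injective (trans (+-comm 1 _) (trans (count-insert i S (λ _ → true) Si) unused≡1+k))))
    (cong₂ (λ p q → fixedAmong p q r)
      (m+n≡o⇒m≡o∸n (count-insert i S (λ x → not (toℕ x <ᵇ suc d)) Si))
      (m+n≡o⇒m≡o∸n (count-insert i S (λ x → toℕ x <ᵇ suc d) Si)))

  unusedBelow-nonempty : ∀ {d k} S (x₀ : Fin m) → toℕ x₀ ≡ d → d + suc k ≡ m → unused S ≡ suc k →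
    S x₀ ≡ true → 0 < unusedBelow d S
  unusedBelow-nonempty {d} {k} S x₀ x₀≡d d+[1+k]≡m unused≡1+k Sx₀ =
    subst (0 <_) (m+n∸m≡n a b) (subst (λ n → 0 < n ∸ a) (sym a+b≡1+k) (m<n⇒0<n∸m (s≤s a≤k)))
    where
    a = unusedFrom (suc d) S
    b = unusedBelow d S
    a+b≡1+k : a + b ≡ suc k
    a+b≡1+k = begin
      a + b                         ≡⟨ cong (λ v → 𝟙 (not v) + a + b) Sx₀ ⟨
      𝟙 (not (S x₀)) + a + b        ≡⟨ cong (_+ b) (unusedFrom-split d S x₀ x₀≡d) ⟨
      unusedFrom d S + b            ≡⟨ unused-split d S ⟨
      unused S                      ≡⟨ unused≡1+k ⟩
      suc k                         ∎
    a≤k : a ≤ k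
    a≤k = ≤-trans (unusedFrom-≤ (suc d) S) (≤-reflexive (begin
      m ∸ suc d                     ≡⟨ cong (_∸ suc d) d+[1+k]≡m ⟨
      d + suc k ∸ suc d             ≡⟨ cong (_∸ suc d) (+-suc d k) ⟩
      d + k ∸ d                     ≡⟨ m+n∸m≡n d k ⟩
      k                             ∎))

  arrangements-step : ∀ {d k} → d + suc k ≡ m → Invariant (suc d) k → Invariant d (suc k)
  arrangements-step {d} {k} d+[1+k]≡m IH S r unused≡1+k = begin
    arrangements d (suc k) S r
      ≡⟨ arrangements-by-position d k S r _ _ _ hα hβ hγ ⟩
    countFin (λ x → (toℕ x ≡ᵇ d) ∧ not (S x)) * α + a * β + b * γ
      ≡⟨ cong₂ (λ c q → c * shift (fixedAmong a (q ∸ 1)) r + a * fixedAmong (a ∸ 1) q r + b * fixedAmong a (q ∸ 1) r)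
               first-free (unusedBelow-split d S x₀ x₀≡d) ⟩
    𝟙 u * shift (fixedAmong a (𝟙 u + b ∸ 1)) r + a * fixedAmong (a ∸ 1) (𝟙 u + b) r + b * fixedAmong a (𝟙 u + b ∸ 1) r
      ≡⟨ fixedAmong-first-position a b r u
           (unusedBelow-nonempty S x₀ x₀≡d d+[1+k]≡m unused≡1+k ∘ not-injective) ⟩
    fixedAmong (𝟙 u + a) b r
      ≡⟨ cong (λ p → fixedAmong p b r) (unusedFrom-split d S x₀ x₀≡d) ⟨
    fixedAmong (unusedFrom d S) b r ∎
    where
    d<m : d < m
    d<m = subst (d <_) d+[1+k]≡m (m<m+n d z<s)
    x₀ = fromℕ< d<m
    x₀≡d : toℕ x₀ ≡ d
    x₀≡d = toℕ-fromℕ< d<m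
    u = not (S x₀)
    a = unusedFrom (suc d) S
    b = unusedBelow d S
    b′ = unusedBelow (suc d) S
    α = shift (fixedAmong a (b′ ∸ 1)) r
    β = fixedAmong (a ∸ 1) b′ r
    γ = fixedAmong a (b′ ∸ 1) r
    first-free : countFin (λ x → (toℕ x ≡ᵇ d) ∧ not (S x)) ≡ 𝟙 u
    first-free = subst (λ e → countFin (λ x → (toℕ x ≡ᵇ e) ∧ not (S x)) ≡ 𝟙 u) x₀≡d (countFin-toℕ x₀ (not ∘ S))
    insert-value : ∀ i → S i ≡ false → ∀ {t} → (toℕ i <ᵇ suc d) ≡ t → ∀ r →
      arrangements (suc d) k (insert i S) r ≡ fixedAmong (a ∸ 𝟙 (not t)) (b′ ∸ 𝟙 t) r
    insert-value i Si = arrangements-insert S i IH unused≡1+k Si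
    hα : ∀ i → S i ≡ false → toℕ i ≡ d → shift (arrangements (suc d) k (insert i S)) r ≡ α
    hα i Si i≡d = shift-cong (insert-value i Si (dec-true (toℕ i <? suc d) (s≤s (≤-reflexive i≡d)))) r
    hβ : ∀ i → S i ≡ false → d < toℕ i → arrangements (suc d) k (insert i S) r ≡ β
    hβ i Si d<i = insert-value i Si (dec-false (toℕ i <? suc d) (<⇒≱ d<i ∘ s≤s⁻¹)) r
    hγ : ∀ i → S i ≡ false → toℕ i < d → arrangements (suc d) k (insert i S) r ≡ γ
    hγ i Si i<d = insert-value i Si (dec-true (toℕ i <? suc d) (m<n⇒m<1+n i<d)) r

  arrangements≡fixedAmong : ∀ k d → d + k ≡ m → Invariant d k
  arrangements≡fixedAmong zero d _ S r none =
    trans (empty r) (sym (cong₂ (λ p q → fixedAmong p q r) (m+n≡0⇒m≡0 _ none′) (m+n≡0⇒n≡0 _ none′)))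
    where
    none′ : unusedFrom d S + unusedBelow d S ≡ 0
    none′ = trans (sym (unused-split d S)) none
    empty : ∀ r → arrangements d 0 S r ≡ fixedAmong 0 0 r
    empty zero    = refl
    empty (suc r) = refl
  arrangements≡fixedAmong (suc k) d d+[1+k]≡m =
    arrangements-step d+[1+k]≡m (arrangements≡fixedAmong k (suc d) (trans (sym (+-suc d k)) d+[1+k]≡m))

  Distinct : ∀ {k} → Vec (Fin m) k → Set
  Distinct {k} v = (i j : Fin k) → lookup v i ≡ lookup v j → i ≡ j

  Avoids : ∀ {k} → Used → Vec (Fin m) k → Set
  Avoids S v = ∀ i → S (lookup v i) ≡ false

  fresh-sound : ∀ {k} S (v : Vec (Fin m) k) → fresh S v ≡ true → Distinct v × Avoids S v
  fresh-sound S []      _ = (λ ()) , (λ ())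
  fresh-sound S (x ∷ w) h with S x in Sx
  fresh-sound S (x ∷ w) () | true
  fresh-sound S (x ∷ w) h  | false = distinct , avoids
    where
    IH = fresh-sound (insert x S) w h
    x∉w : ∀ j → lookup w j ≢ x
    x∉w j wj≡x = contradiction
      (trans (sym (cong (_∨ S (lookup w j)) (dec-true (lookup w j ≟ᶠ x) wj≡x))) (proj₂ IH j)) λ ()
    distinct : Distinct (x ∷ w)
    distinct zero    zero    _ = refl
    distinct zero    (suc j) e = contradiction (sym e) (x∉w j)
    distinct (suc i) zero    e = contradiction e (x∉w i)
    distinct (suc i) (suc j) e = cong suc (proj₁ IH i j e)
    avoids : Avoids S (x ∷ w)
    avoids zero    = Sx
    avoids (suc j) with lookup w j ≟ᶠ x | proj₂ IH j
    ... | yes wj≡x | _   = contradiction wj≡x (x∉w j)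
    ... | no  _    | Swj = Swj

  fresh-complete : ∀ {k} S (v : Vec (Fin m) k) → Distinct v → Avoids S v → fresh S v ≡ true
  fresh-complete S []      _        _      = refl
  fresh-complete S (x ∷ w) distinct avoids rewrite avoids zero =
    fresh-complete (insert x S) w (λ i j e → Fin.suc-injective (distinct (suc i) (suc j) e)) avoids′
    where
    avoids′ : Avoids (insert x S) w
    avoids′ j = trans
      (cong (_∨ S (lookup w j)) (dec-false (lookup w j ≟ᶠ x) (λ e → contradiction (distinct zero (suc j) (sym e)) λ ())))
      (avoids (suc j))

  does-isPermutation? : (σ : Vec (Fin m) m) → does (isPermutation? σ) ≡ fresh (λ _ → false) σ
  does-isPermutation? σ with fresh (λ _ → false) σ in e
  ... | true  = dec-true (isPermutation? σ) (proj₁ (fresh-sound (λ _ → false) σ e))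
  ... | false = dec-false (isPermutation? σ)
                  (λ perm → contradiction (trans (sym (fresh-complete (λ _ → false) σ perm (λ _ → refl))) e) λ ())

  fixedFrom-lookup : ∀ {k} d (v : Vec (Fin m) k) → ∑[ i < k ] 𝟙 (toℕ (lookup v i) ≡ᵇ d + toℕ i) ≡ fixedFrom d v
  fixedFrom-lookup d []      = refl
  fixedFrom-lookup d (x ∷ v) = cong₂ _+_
    (cong (λ e → 𝟙 (toℕ x ≡ᵇ e)) (+-identityʳ d))
    (trans (sum-cong-≗ λ i → cong (λ e → 𝟙 (toℕ (lookup v i) ≡ᵇ e)) (+-suc d (toℕ i))) (fixedFrom-lookup (suc d) v))

  fixedPoints≡fixedFrom : (σ : Vec (Fin m) m) → fixedPoints σ ≡ fixedFrom 0 σ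
  fixedPoints≡fixedFrom σ = begin
    fixedPoints σ
      ≡⟨ length-filter≡count (λ i → lookup σ i ≟ᶠ i) (allFin m) ⟩
    count (λ i → does (lookup σ i ≟ᶠ i)) (allFin m)
      ≡⟨ count-tabulate (λ i → does (lookup σ i ≟ᶠ i)) (λ i → i) ⟩
    ∑[ i < m ] 𝟙 (does (lookup σ i ≟ᶠ i))
      ≡⟨ sum-cong-≗ (λ i → cong 𝟙 (does-≟ᶠ (lookup σ i) i)) ⟩
    ∑[ i < m ] 𝟙 (toℕ (lookup σ i) ≡ᵇ toℕ i)
      ≡⟨ fixedFrom-lookup 0 σ ⟩
    fixedFrom 0 σ ∎

  D≡fixedAmong : ∀ r → D m r ≡ fixedAmong m 0 r
  D≡fixedAmong r = begin
    D m r
      ≡⟨ length-filter≡count _ (allVecs m m) ⟩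
    count (λ σ → does (isPermutation? σ) ∧ (fixedPoints σ ≡ᵇ r)) (allVecs m m)
      ≡⟨ count-cong (λ σ → cong₂ (λ p f → p ∧ (f ≡ᵇ r)) (does-isPermutation? σ) (fixedPoints≡fixedFrom σ))
                    (allVecs m m) ⟩
    arrangements 0 m (λ _ → false) r
      ≡⟨ arrangements≡fixedAmong m 0 refl (λ _ → false) r (countFin-true m) ⟩
    fixedAmong (unusedFrom 0 (λ _ → false)) (unusedBelow 0 (λ _ → false)) r
      ≡⟨ cong₂ (λ p q → fixedAmong p q r) (countFin-true m) (countFin-false m) ⟩
    fixedAmong m 0 r ∎

D[n,0]≡noFixedAmong : ∀ n → D n 0 ≡ noFixedAmong n 0
D[n,0]≡noFixedAmong n = trans (Arrangements.D≡fixedAmong n 0) (fixedAmong-zero n 0)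

D-binomial : ∀ s r → D (s + r) r ≡ ((s + r) C r) * D s 0
D-binomial s r = begin
  D (s + r) r                                  ≡⟨ Arrangements.D≡fixedAmong (s + r) r ⟩
  ((s + r) C r) * noFixedAmong (s + r ∸ r) 0   ≡⟨ cong (λ t → ((s + r) C r) * noFixedAmong t 0) (m+n∸n≡m s r) ⟩
  ((s + r) C r) * noFixedAmong s 0             ≡⟨ cong (((s + r) C r) *_) (D[n,0]≡noFixedAmong s) ⟨
  ((s + r) C r) * D s 0                        ∎

derangements-suc : ∀ n → D (2 + n) 0 ≡ suc n * (D (suc n) 0 + D n 0)
derangements-suc n = begin
  D (2 + n) 0                                         ≡⟨ D[n,0]≡noFixedAmong (2 + n) ⟩
  suc n * noFixedAmong n 1 + 0                        ≡⟨ +-identityʳ _ ⟩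
  suc n * noFixedAmong n 1                            ≡⟨ cong (suc n *_) (noFixedAmong-free n 0) ⟩
  suc n * (noFixedAmong (suc n) 0 + noFixedAmong n 0) ≡⟨ cong₂ (λ a b → suc n * (a + b))
                                                           (D[n,0]≡noFixedAmong (suc n)) (D[n,0]≡noFixedAmong n) ⟨
  suc n * (D (suc n) 0 + D n 0)                       ∎

D-binomial-reindexed : ∀ c k r → D (k + r + c) r ≡ ((k + r + c) C r) * D (c + k) 0
D-binomial-reindexed c k r = subst (λ n → D n r ≡ (n C r) * D (c + k) 0) (reorder c k r) (D-binomial (c + k) r)
  where
  reorder : ∀ c k r → c + k + r ≡ k + r + c
  reorder = solve-∀

-- The alternating sum

/-cross : ∀ a b n d .{{_ : NonZero n}} .{{_ : NonZero d}} → a *ℤ + d ≡ b *ℤ + n → a / n ≡ b / d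
/-cross a b (suc n) (suc d) eq = ℚP.fromℚᵘ-cong {mkℚᵘ a n} {mkℚᵘ b d} (*≡* eq)

/1-+ : ∀ a b → a / 1 +ℚ b / 1 ≡ (a ℤ.+ b) / 1
/1-+ a b = ℚP.toℚᵘ-injective
  (≃-trans (ℚP.toℚᵘ-homo-+ (a / 1) (b / 1))
  (≃-trans (ℚᵘP.+-cong (ℚP.toℚᵘ-fromℚᵘ (mkℚᵘ a 0)) (ℚP.toℚᵘ-fromℚᵘ (mkℚᵘ b 0)))
  (≃-trans (*≡* (distrib a b))
           (≃-sym (ℚP.toℚᵘ-fromℚᵘ (mkℚᵘ (a ℤ.+ b) 0))))))
  where
  open ℚᵘP using (≃-trans; ≃-sym)
  distrib : ∀ a b → (a *ℤ + 1 ℤ.+ b *ℤ + 1) *ℤ + 1 ≡ (a ℤ.+ b) *ℤ + 1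
  distrib = ℤ-Solver.solve-∀

∑₁-cong : ∀ n {f g : ℕ → ℚ} → (∀ k → f (suc k) ≡ g (suc k)) → ∑₁ n f ≡ ∑₁ n g
∑₁-cong zero    _   = refl
∑₁-cong (suc n) f≗g = cong₂ _+ℚ_ (∑₁-cong n f≗g) (f≗g n)

∑₁-telescope : ∀ (g : ℕ → ℤ) n → ∑₁ n (λ k → (g k ℤ.- g (pred k)) / 1) ≡ (g n ℤ.- g 0) / 1
∑₁-telescope g zero    = cong (_/ 1) (sym (ℤP.+-inverseʳ (g 0)))
∑₁-telescope g (suc n) = begin
  ∑₁ n (λ k → (g k ℤ.- g (pred k)) / 1) +ℚ (g (suc n) ℤ.- g n) / 1
    ≡⟨ cong (_+ℚ (g (suc n) ℤ.- g n) / 1) (∑₁-telescope g n) ⟩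
  (g n ℤ.- g 0) / 1 +ℚ (g (suc n) ℤ.- g n) / 1
    ≡⟨ /1-+ (g n ℤ.- g 0) (g (suc n) ℤ.- g n) ⟩
  ((g n ℤ.- g 0) ℤ.+ (g (suc n) ℤ.- g n)) / 1
    ≡⟨ cong (_/ 1) (collapse (g n) (g 0) (g (suc n))) ⟩
  (g (suc n) ℤ.- g 0) / 1 ∎
  where
  collapse : ∀ x y z → (x ℤ.- y) ℤ.+ (z ℤ.- x) ≡ z ℤ.- y
  collapse = ℤ-Solver.solve-∀

cancel-common-factor : ∀ s x c n → (s *ℤ + (c * x)) *ℤ + n ≡ (s *ℤ + x) *ℤ + (n * c)
cancel-common-factor s x c n = begin
  (s *ℤ + (c * x)) *ℤ + n        ≡⟨ cong (λ t → (s *ℤ t) *ℤ + n) (ℤP.pos-* c x) ⟩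
  (s *ℤ (+ c *ℤ + x)) *ℤ + n     ≡⟨ regroup s (+ c) (+ x) (+ n) ⟩
  (s *ℤ + x) *ℤ (+ n *ℤ + c)     ≡⟨ cong ((s *ℤ + x) *ℤ_) (ℤP.pos-* n c) ⟨
  (s *ℤ + x) *ℤ + (n * c)        ∎
  where
  regroup : ∀ s c x n → (s *ℤ (c *ℤ x)) *ℤ n ≡ (s *ℤ x) *ℤ (n *ℤ c)
  regroup = ℤ-Solver.solve-∀

summand : ℕ → ℕ → ℚ
summand r k = _/_ ((-1ℤ ^ℤ k) *ℤ (+ D (k + r + 3) r)) ((k + 2) * ((k + r + 3) C r)) {{denom-nz k r 3}}

signedDerangement : ℕ → ℤ
signedDerangement k = (-1ℤ ^ℤ k) *ℤ + D (2 + k) 0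

signedDerangement-zero : signedDerangement 0 ≡ + 1
signedDerangement-zero = refl

summand-cancel : ∀ r k → summand r k ≡ ((-1ℤ ^ℤ k) *ℤ + D (3 + k) 0) / (2 + k)
summand-cancel r k =
  trans (cong (λ x → _/_ ((-1ℤ ^ℤ k) *ℤ + x) ((k + 2) * c) {{denom-nz k r 3}}) (D-binomial-reindexed 3 k r))
        (/-cross ((-1ℤ ^ℤ k) *ℤ + (c * D (3 + k) 0)) ((-1ℤ ^ℤ k) *ℤ + D (3 + k) 0) ((k + 2) * c) (2 + k) {{denom-nz k r 3}}
          (trans (cong (λ n → (-1ℤ ^ℤ k) *ℤ + (c * D (3 + k) 0) *ℤ + n) (+-comm 2 k))
                 (cancel-common-factor (-1ℤ ^ℤ k) (D (3 + k) 0) c (k + 2))))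
  where
  c = (k + r + 3) C r

summand-telescopes : ∀ r k → summand r (suc k) ≡ (signedDerangement (suc k) ℤ.- signedDerangement k) / 1
summand-telescopes r k = trans (summand-cancel r (suc k))
  (/-cross ((-1ℤ ^ℤ suc k) *ℤ + D (3 + suc k) 0) (signedDerangement (suc k) ℤ.- signedDerangement k) (3 + k) 1 eq)
  where
  s = -1ℤ ^ℤ k
  A = D (3 + k) 0
  B = D (2 + k) 0
  split : ∀ s n a b → (-1ℤ *ℤ s *ℤ (n *ℤ (a ℤ.+ b))) *ℤ + 1 ≡ (-1ℤ *ℤ s *ℤ a ℤ.- s *ℤ b) *ℤ n
  split = ℤ-Solver.solve-∀
  eq : (-1ℤ *ℤ s *ℤ + D (3 + suc k) 0) *ℤ + 1 ≡ (-1ℤ *ℤ s *ℤ + A ℤ.- s *ℤ + B) *ℤ + (3 + k)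
  eq = begin
    (-1ℤ *ℤ s *ℤ + D (3 + suc k) 0) *ℤ + 1
      ≡⟨ cong (λ t → (-1ℤ *ℤ s *ℤ t) *ℤ + 1) (begin
           + D (3 + suc k) 0            ≡⟨ cong +_ (derangements-suc (suc (suc k))) ⟩
           + ((3 + k) * (A + B))        ≡⟨ ℤP.pos-* (3 + k) (A + B) ⟩
           + (3 + k) *ℤ + (A + B)       ≡⟨ cong (+ (3 + k) *ℤ_) (ℤP.pos-+ A B) ⟩
           + (3 + k) *ℤ (+ A ℤ.+ + B)   ∎) ⟩
    (-1ℤ *ℤ s *ℤ (+ (3 + k) *ℤ (+ A ℤ.+ + B))) *ℤ + 1
      ≡⟨ split s (+ (3 + k)) (+ A) (+ B) ⟩
    (-1ℤ *ℤ s *ℤ + A ℤ.- s *ℤ + B) *ℤ + (3 + k) ∎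

rhs-cancel : ∀ r n →
  _/_ ((-1ℤ ^ℤ n) *ℤ (+ D (n + r + 2) r)) ((n + r + 2) C r) {{binom-nz n r 2}} ≡ signedDerangement n / 1
rhs-cancel r n =
  trans (cong (λ x → _/_ (s *ℤ + x) c {{binom-nz n r 2}}) (D-binomial-reindexed 2 n r))
        (/-cross (s *ℤ + (c * D (2 + n) 0)) (signedDerangement n) c 1 {{binom-nz n r 2}}
          (trans (cancel-common-factor s (D (2 + n) 0) c 1) (cong (λ t → signedDerangement n *ℤ + t) (*-identityˡ c))))
  where
  s = -1ℤ ^ℤ n
  c = (n + r + 2) C r

mainTheorem4 : (r n : ℕ) → 1 ≤ n →
    1ℚ +ℚ ∑₁ n (λ k → _/_ ((-1ℤ ^ℤ k) *ℤ (+ D (k + r + 3) r)) ((k + 2) * ((k + r + 3) C r)) {{denom-nz k r 3}})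
      ≡ _/_ ((-1ℤ ^ℤ n) *ℤ (+ D (n + r + 2) r)) ((n + r + 2) C r) {{binom-nz n r 2}}
mainTheorem4 r n _ = begin
  1ℚ +ℚ ∑₁ n (summand r)
    ≡⟨ cong (1ℚ +ℚ_) (∑₁-cong n (summand-telescopes r)) ⟩
  1ℚ +ℚ ∑₁ n (λ k → (signedDerangement k ℤ.- signedDerangement (pred k)) / 1)
    ≡⟨ cong (1ℚ +ℚ_) (∑₁-telescope signedDerangement n) ⟩
  1ℚ +ℚ (signedDerangement n ℤ.- signedDerangement 0) / 1
    ≡⟨ cong (λ z → 1ℚ +ℚ (signedDerangement n ℤ.- z) / 1) signedDerangement-zero ⟩
  + 1 / 1 +ℚ (signedDerangement n ℤ.- + 1) / 1
    ≡⟨ /1-+ (+ 1) (signedDerangement n ℤ.- + 1) ⟩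
  (+ 1 ℤ.+ (signedDerangement n ℤ.- + 1)) / 1
    ≡⟨ cong (_/ 1) (cancel (signedDerangement n)) ⟩
  signedDerangement n / 1
    ≡⟨ rhs-cancel r n ⟨
  _/_ ((-1ℤ ^ℤ n) *ℤ (+ D (n + r + 2) r)) ((n + r + 2) C r) {{binom-nz n r 2}} ∎
  where
  cancel : ∀ x → + 1 ℤ.+ (x ℤ.- + 1) ≡ x
  cancel = ℤ-Solver.solve-∀
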